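{- There is an absolute constant $C>0$ such that for every prime $p>3$ and every prime $\ell>2$, $\mathrm{Loss}(p,\ell)\le C\,\log^2\ell/\log p$; that is, $\mathrm{Loss}(p,\ell)=O(\log^2\ell/\log p)$.
   Context: For a prime $p$ and a positive integer $r$, $\mathrm{PDiv}(p,r)=\max\{k\in\mathbb{N} : p^k \text{ divides } r\}$. For $i\ge 1$, $\mathrm{LpLoss}(p,\ell,i)=\max\{\mathrm{PDiv}(p,r) : 2^i+1\le r\le \min(2^{i+1},4\ell-1)\}$, and $\mathrm{Loss}(p,\ell)=\sum_{1\le i<\log_2(4\ell-1)}\mathrm{LpLoss}(p,\ell,i)$. -}

module Defs where

open import Data.Nat using (ℕ; suc; _+_; _*_; _∸_; _^_; _⊔_; _⊓_; _<?_)
open import Data.Nat.Divisibility using (_∣?_)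
open import Data.List using (List; foldr; map; filter; upTo)
open import Data.Nat.ListAction using (sum)

maxList : List ℕ → ℕ
maxList = foldr _⊔_ 0

range : ℕ → ℕ → List ℕ
range a b = map (a +_) (upTo (suc b ∸ a))

-- PDiv p r = max { k : p^k ∣ r }.  For p ≥ 2 and r ≥ 1 every such k
-- satisfies k ≤ r, so the max over k ∈ [0, r] is the full max.
PDiv : ℕ → ℕ → ℕ
PDiv p r = maxList (filter (λ k → p ^ k ∣? r) (upTo (suc r)))

LpLoss : ℕ → ℕ → ℕ → ℕ
LpLoss p ℓ i = maxList (map (PDiv p) (range (2 ^ i + 1) ((2 ^ suc i) ⊓ (4 * ℓ ∸ 1))))

-- Loss p ℓ = Σ_{1 ≤ i < log₂(4ℓ-1)} LpLoss p ℓ i.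
-- i < log₂(4ℓ-1) (real log) ⇔ 2^i < 4ℓ-1, and such i satisfy i < 4ℓ.
Loss : ℕ → ℕ → ℕ
Loss p ℓ = sum (map (LpLoss p ℓ) (filter (λ i → 2 ^ i <? 4 * ℓ ∸ 1) (range 1 (4 * ℓ))))

module Submission where

open import Defs
open import Data.Nat using (ℕ; _*_; _≤_; _<_)
open import Data.Nat.Primality using (Prime)
open import Data.Nat.Logarithm using (⌊log₂_⌋)
open import Data.Product using (∃-syntax)

open import Data.Nat using (zero; suc; _+_; _∸_; _^_; _⊓_; _<?_; z≤n; s≤s; s≤s⁻¹; ⌊_/2⌋; >-nonZero)
open import Data.Nat.Properties
open import Data.Nat.Divisibility using (_∣_; _∣?_; ∣⇒≤)
open import Data.Nat.Induction using (<-wellFounded)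
open import Data.Nat.Logarithm using (⌊log₂⌋-mono-≤; ⌊log₂[2^n]⌋≡n)
open import Data.Nat.Logarithm.Core using (⌊log2⌋)
open import Data.Nat.ListAction using (sum)
open import Data.Nat.Tactic.RingSolver using (solve-∀)
open import Data.List using (List; []; _∷_; map; filter; upTo; length)
open import Data.List.Relation.Unary.All as All using (All; []; _∷_)
open import Data.List.Relation.Unary.All.Properties using (all-filter; filter⁺; map⁺; applyUpTo⁺₁)
open import Data.List.Relation.Unary.AllPairs using (AllPairs; []; _∷_)
import Data.List.Relation.Unary.AllPairs.Properties as AllPairs
open import Data.Product using (_,_; _×_)
open import Function using (id)
open import Induction.WellFounded using (Acc; acc)
open import Relation.Unary using (Decidable)
open import Relation.Binary.PropositionalEquality using (_≡_; sym; subst)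

-- Write c = ⌊log₂ p⌋ and L = ⌊log₂ ℓ⌋, and let K = L + 2.
-- Every r occurring in Loss p ℓ satisfies 1 ≤ r < 4ℓ < 2^(K+1).  If p^k ∣ r
-- then 2^(c·k) ≤ p^k ≤ r < 2^(K+1), so k·c ≤ K; taking maxima, every
-- PDiv p r, and hence every LpLoss p ℓ i, is at most K after scaling by c.
-- The summation indices i satisfy 2^i < 4ℓ - 1 < 2^(K+1), so they form a
-- strictly increasing list inside [1, K] and there are at most K of them.
-- Thus Loss p ℓ · c ≤ K², and K = L + 2 ≤ 3L once ℓ ≥ 2, giving the
-- constant C = 9.

double-half≤ : ∀ n → 2 * ⌊ n /2⌋ ≤ n
double-half≤ zero          = z≤n
double-half≤ (suc zero)    = z≤n
double-half≤ (suc (suc n)) =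
  ≤-trans (≤-reflexive (*-suc 2 ⌊ n /2⌋)) (s≤s (s≤s (double-half≤ n)))

-- 2^⌊log₂ n⌋ ≤ n, by recursion along the accessibility proof defining ⌊log₂⌋:
-- ⌊log₂ (n+2)⌋ = 1 + ⌊log₂ ⌊(n+2)/2⌋⌋.
2^⌊log2⌋≤ : ∀ n (rec : Acc _<_ n) → 1 ≤ n → 2 ^ ⌊log2⌋ n rec ≤ n
2^⌊log2⌋≤ (suc zero)    _        _ = ≤-refl
2^⌊log2⌋≤ (suc (suc n)) (acc rs) _ =
  ≤-trans (*-monoʳ-≤ 2 (2^⌊log2⌋≤ (suc ⌊ n /2⌋) (rs (⌊n/2⌋<n (suc n))) (s≤s z≤n)))
          (double-half≤ (suc (suc n)))

2^⌊log₂n⌋≤n : ∀ n → 1 ≤ n → 2 ^ ⌊log₂ n ⌋ ≤ n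
2^⌊log₂n⌋≤n n = 2^⌊log2⌋≤ n (<-wellFounded n)

-- n < 2^(⌊log₂ n⌋ + 1): otherwise monotonicity of ⌊log₂⌋ gives ⌊log₂ n⌋ + 1 ≤ ⌊log₂ n⌋.
n<2^suc⌊log₂n⌋ : ∀ n → n < 2 ^ suc ⌊log₂ n ⌋
n<2^suc⌊log₂n⌋ n = ≰⇒> λ 2^≤n →
  n≮n ⌊log₂ n ⌋ (subst (_≤ ⌊log₂ n ⌋) (⌊log₂[2^n]⌋≡n (suc ⌊log₂ n ⌋)) (⌊log₂⌋-mono-≤ 2^≤n))

-- ⌊log₂ n⌋ is positive for n ≥ 2 (⌊log₂ 2⌋ computes to 1).
1≤⌊log₂n⌋ : ∀ {n} → 2 ≤ n → 1 ≤ ⌊log₂ n ⌋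
1≤⌊log₂n⌋ = ⌊log₂⌋-mono-≤

2^-cancel-< : ∀ {a b} → 2 ^ a < 2 ^ b → a < b
2^-cancel-< lt = ≰⇒> λ b≤a → <⇒≱ lt (^-monoʳ-≤ 2 b≤a)

-- The key estimate: if p^k divides a positive r < 2^m then k·⌊log₂ p⌋ < m,
-- because 2^(⌊log₂ p⌋·k) ≤ p^k ≤ r.
exponent-bound : ∀ {p k r m} → 1 ≤ p → 1 ≤ r → r < 2 ^ m → p ^ k ∣ r → k * ⌊log₂ p ⌋ < m
exponent-bound {p} {k} {r} {m} 1≤p 1≤r r<2^m pᵏ∣r =
  subst (_< m) (*-comm ⌊log₂ p ⌋ k) (2^-cancel-< (begin-strict
    2 ^ (⌊log₂ p ⌋ * k)  ≡⟨ ^-*-assoc 2 ⌊log₂ p ⌋ k ⟨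
    (2 ^ ⌊log₂ p ⌋) ^ k  ≤⟨ ^-monoˡ-≤ k (2^⌊log₂n⌋≤n p 1≤p) ⟩
    p ^ k                ≤⟨ ∣⇒≤ {{>-nonZero 1≤r}} pᵏ∣r ⟩
    r                    <⟨ r<2^m ⟩
    2 ^ m                ∎))
  where open ≤-Reasoning

maxList-scaled-≤ : ∀ c {B xs} → All (λ x → x * c ≤ B) xs → maxList xs * c ≤ B
maxList-scaled-≤ c []                    = z≤n
maxList-scaled-≤ c {B} {x ∷ xs} (h ∷ hs) =
  subst (_≤ B) (sym (*-distribʳ-⊔ c x (maxList xs))) (⊔-lub h (maxList-scaled-≤ c hs))

sum-scaled-≤ : ∀ {c B} (g : ℕ → ℕ) → (∀ x → g x * c ≤ B) →
               ∀ xs → sum (map g xs) * c ≤ length xs * B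
sum-scaled-≤         g h []       = z≤n
sum-scaled-≤ {c} {B} g h (x ∷ xs) =
  subst (_≤ B + length xs * B) (sym (*-distribʳ-+ c (g x) (sum (map g xs))))
    (+-mono-≤ (h x) (sum-scaled-≤ g h xs))

increasing-length : ∀ {a b xs} → AllPairs _<_ xs → All (λ x → a ≤ x × x ≤ b) xs →
                    length xs ≤ suc b ∸ a
increasing-length []                  []                         = z≤n
increasing-length (x<rest ∷ ascending) ((a≤x , x≤b) ∷ inBounds) =
  ≤-trans (s≤s (increasing-length ascending
                 (All.zipWith (λ { (x<y , _ , y≤b) → ≤-trans (s≤s a≤x) x<y , y≤b })
                              (x<rest , inBounds))))
          (≤-reflexive (sym (+-∸-assoc 1 (≤-trans a≤x x≤b))))

<∸⇒+≤ : ∀ a b j → j < suc b ∸ a → a + j ≤ b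
<∸⇒+≤ zero          b       j lt = s≤s⁻¹ lt
<∸⇒+≤ (suc a)       (suc b) j lt = s≤s (<∸⇒+≤ a b j lt)
<∸⇒+≤ (suc zero)    zero    j ()
<∸⇒+≤ (suc (suc a)) zero    j ()

range-bounds : ∀ a b → All (λ y → a ≤ y × y ≤ b) (range a b)
range-bounds a b = map⁺ (applyUpTo⁺₁ id (suc b ∸ a) λ {j} j< → m≤m+n a j , <∸⇒+≤ a b j j<)

range-increasing : ∀ a b → AllPairs _<_ (range a b)
range-increasing a b =
  AllPairs.map⁺ (AllPairs.applyUpTo⁺₁ id (suc b ∸ a) λ i<j _ → +-monoʳ-< a i<j)

module LossBound (p ℓ : ℕ) (1≤p : 1 ≤ p) where

  K : ℕ
  K = 2 + ⌊log₂ ℓ ⌋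

  4ℓ<2^[K+1] : 4 * ℓ < 2 ^ suc K
  4ℓ<2^[K+1] = subst (4 * ℓ <_) (*-assoc 2 2 (2 ^ suc ⌊log₂ ℓ ⌋))
                     (*-monoʳ-< 4 (n<2^suc⌊log₂n⌋ ℓ))

  PDiv-bound : ∀ r → 1 ≤ r → r ≤ 4 * ℓ ∸ 1 → PDiv p r * ⌊log₂ p ⌋ ≤ K
  PDiv-bound r 1≤r r≤ =
    maxList-scaled-≤ ⌊log₂ p ⌋
      (All.map (λ {k} → exponent≤K {k}) (all-filter (λ k → p ^ k ∣? r) (upTo (suc r))))
    where
      r<2^[K+1] : r < 2 ^ suc K
      r<2^[K+1] = ≤-<-trans (≤-trans r≤ (m∸n≤m (4 * ℓ) 1)) 4ℓ<2^[K+1]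
      exponent≤K : ∀ {k} → p ^ k ∣ r → k * ⌊log₂ p ⌋ ≤ K
      exponent≤K {k} pᵏ∣r = s≤s⁻¹ (exponent-bound {p} {k} {r} {suc K} 1≤p 1≤r r<2^[K+1] pᵏ∣r)

  LpLoss-bound : ∀ i → LpLoss p ℓ i * ⌊log₂ p ⌋ ≤ K
  LpLoss-bound i = maxList-scaled-≤ ⌊log₂ p ⌋ (map⁺ (All.map
    (λ { (lo , hi) → PDiv-bound _ (≤-trans (m≤n+m 1 (2 ^ i)) lo) (≤-trans hi (m⊓n≤n _ _)) })
    (range-bounds (2 ^ i + 1) (2 ^ suc i ⊓ (4 * ℓ ∸ 1)))))

  -- The summation indices of Loss: 1 ≤ i and 2^i < 4ℓ - 1 < 2^(K+1), so i ≤ K.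
  indices : List ℕ
  indices = filter (λ i → 2 ^ i <? 4 * ℓ ∸ 1) (range 1 (4 * ℓ))

  indices-count : length indices ≤ K
  indices-count = increasing-length
    (AllPairs.filter⁺ Q? (range-increasing 1 (4 * ℓ)))
    (All.zipWith (λ { ((1≤i , _) , 2^i<) → 1≤i , index≤K 2^i< })
                 (filter⁺ Q? (range-bounds 1 (4 * ℓ)) , all-filter Q? (range 1 (4 * ℓ))))
    where
      Q? : Decidable (λ i → 2 ^ i < 4 * ℓ ∸ 1)
      Q? i = 2 ^ i <? 4 * ℓ ∸ 1
      index≤K : ∀ {i} → 2 ^ i < 4 * ℓ ∸ 1 → i ≤ K
      index≤K 2^i< = s≤s⁻¹ (2^-cancel-<
        (<-trans 2^i< (≤-<-trans (m∸n≤m (4 * ℓ) 1) 4ℓ<2^[K+1])))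

  Loss-bound : Loss p ℓ * ⌊log₂ p ⌋ ≤ K * K
  Loss-bound = ≤-trans (sum-scaled-≤ (LpLoss p ℓ) LpLoss-bound indices)
                       (*-monoˡ-≤ K indices-count)

square-bound : ∀ {L} → 1 ≤ L → (2 + L) * (2 + L) ≤ 9 * (L * L)
square-bound {L} 1≤L = begin
  (2 + L) * (2 + L)  ≤⟨ *-mono-≤ 2+L≤3L 2+L≤3L ⟩
  (3 * L) * (3 * L)  ≡⟨ square-3x L ⟩
  9 * (L * L)        ∎
  where
    open ≤-Reasoning
    3x≡x+x+x : ∀ x → 3 * x ≡ x + x + x
    3x≡x+x+x = solve-∀
    square-3x : ∀ x → (3 * x) * (3 * x) ≡ 9 * (x * x)
    square-3x = solve-∀
    2+L≤3L : 2 + L ≤ 3 * L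
    2+L≤3L = subst (2 + L ≤_) (sym (3x≡x+x+x L)) (+-monoˡ-≤ L (+-mono-≤ 1≤L 1≤L))

mainTheorem4 : ∃[ C ] ((p ℓ : ℕ) → Prime p → 3 < p → Prime ℓ → 2 < ℓ →
    Loss p ℓ * ⌊log₂ p ⌋ ≤ C * (⌊log₂ ℓ ⌋ * ⌊log₂ ℓ ⌋))
mainTheorem4 = 9 , λ p ℓ _ 3<p _ 2<ℓ →
  ≤-trans (LossBound.Loss-bound p ℓ (≤-trans (s≤s z≤n) (<⇒≤ 3<p)))
          (square-bound (1≤⌊log₂n⌋ (<⇒≤ 2<ℓ)))
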